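{- Let $\mathcal{G}=(V,E,\mathcal{E})$ be an extended graph and let $v\in V$ satisfy $\deg(v)=0$ and $\deg_2(v)\le 1$. Then $v$ is contained in some maximum 2-packing set of $\mathcal{G}$. Consequently, with $\mathcal{G}'=\mathcal{G}[V\setminus N^2[v]]$, we have $\beta(\mathcal{G})=\beta(\mathcal{G}')+1$.
   Context: Let $H=(V_H,E_H)$ be a finite simple undirected graph and let $\mathcal{E}_H$ be the set of unordered pairs $\{x,y\}$ of distinct vertices with $\{x,y\}\notin E_H$ that have a common neighbor in $H$. An extended graph $\mathcal{G}=(V,E,\mathcal{E})$ is obtained from such an $H$ by choosing $V\subseteq V_H$ and letting $E$ (resp. $\mathcal{E}$) be the pairs of $E_H$ (resp. $\mathcal{E}_H$) with both endpoints in $V$. For $U\subseteq V$, $\mathcal{G}[U]$ denotes the extended graph on $U$ keeping exactly the pairs of $E$ and of $\mathcal{E}$ with both endpoints in $U$. For $v\in V$: $N(v)=\{x:\{x,v\}\in E\}$, $N[v]=N(v)\cup\{v\}$, $\deg(v)=|N(v)|$, $N^2(v)=\{x:\{x,v\}\in\mathcal{E}\}$, $N^2[v]=N^2(v)\cup N[v]$, $\deg_2(v)=|N^2(v)|$. A 2-packing set of $\mathcal{G}$ is a set $S\subseteq V$ such that no two distinct vertices of $S$ form a pair in $E\cup\mathcal{E}$; a maximum 2-packing set is one of maximum cardinality, and $\beta(\mathcal{G})$ is this maximum cardinality. -}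

module Defs where

open import Data.Nat using (ℕ; _≤_)
open import Data.Bool using (Bool; true; false; _∧_; not)
open import Data.Fin using (Fin; _≟_)
open import Data.Fin.Subset using (Subset; _∈_; _⊆_; ∣_∣; _─_; _∪_; ⁅_⁆)
open import Data.Fin.Properties using (any?)
open import Data.Vec using (tabulate)
open import Data.Product using (Σ; ∃; _×_; _,_)
open import Data.Sum using (_⊎_)
open import Relation.Nullary using (¬_; does)
open import Relation.Binary.PropositionalEquality using (_≡_; _≢_)

record SimpleGraph (n : ℕ) : Set where
  field
    adj   : Fin n → Fin n → Bool
    sym   : ∀ x y → adj x y ≡ adj y x
    irrefl : ∀ x → adj x x ≡ false
open SimpleGraph public

extH : ∀ {n} → SimpleGraph n → Fin n → Fin n → Bool
extH H x y =
  not (does (x ≟ y)) ∧ not (adj H x y) ∧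
  does (any? (λ w → adj H x w ∧ adj H w y Data.Bool.≟ true))

-- An extended graph: a host graph H together with a vertex subset V ⊆ V_H.
-- Its E (resp. ℰ) are the pairs of E_H (resp. ℰ_H) with both ends in V.
record ExtGraph (n : ℕ) : Set where
  constructor mkExt
  field
    host : SimpleGraph n
    V    : Subset n
open ExtGraph public

EdgeE : ∀ {n} → ExtGraph n → Fin n → Fin n → Set
EdgeE G x y = x ∈ V G × y ∈ V G × adj (host G) x y ≡ true

EdgeEx : ∀ {n} → ExtGraph n → Fin n → Fin n → Set
EdgeEx G x y = x ∈ V G × y ∈ V G × extH (host G) x y ≡ true

inV : ∀ {n} → ExtGraph n → Fin n → Bool
inV G x = does (x Data.Fin.Subset.Properties.∈? V G)
  where import Data.Fin.Subset.Properties

N : ∀ {n} → ExtGraph n → Fin n → Subset n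
N G v = tabulate (λ x → inV G x ∧ inV G v ∧ adj (host G) x v)

N[_] : ∀ {n} → ExtGraph n → Fin n → Subset n
N[ G ] v = N G v ∪ ⁅ v ⁆

N² : ∀ {n} → ExtGraph n → Fin n → Subset n
N² G v = tabulate (λ x → inV G x ∧ inV G v ∧ extH (host G) x v)

N²[_] : ∀ {n} → ExtGraph n → Fin n → Subset n
N²[ G ] v = N² G v ∪ N[ G ] v

deg : ∀ {n} → ExtGraph n → Fin n → ℕ
deg G v = ∣ N G v ∣

deg₂ : ∀ {n} → ExtGraph n → Fin n → ℕ
deg₂ G v = ∣ N² G v ∣

-- induced extended graph 𝒢[U]: same host, vertex set U
-- (intended for U ⊆ V; then E and ℰ restrict exactly as in the paper)
induced : ∀ {n} → ExtGraph n → Subset n → ExtGraph n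
induced G U = mkExt (host G) U

IsTwoPacking : ∀ {n} → ExtGraph n → Subset n → Set
IsTwoPacking G S =
  S ⊆ V G ×
  (∀ {x y} → x ∈ S → y ∈ S → x ≢ y → ¬ (EdgeE G x y ⊎ EdgeEx G x y))

IsMaxTwoPacking : ∀ {n} → ExtGraph n → Subset n → Set
IsMaxTwoPacking G S =
  IsTwoPacking G S × (∀ T → IsTwoPacking G T → ∣ T ∣ ≤ ∣ S ∣)

-- β(𝒢) = k : k is the cardinality of a maximum 2-packing set
-- (maximum 2-packing sets always exist, ∅ being a 2-packing of a finite graph)
IsBeta : ∀ {n} → ExtGraph n → ℕ → Set
IsBeta G k = Σ (Subset _) (λ S → IsMaxTwoPacking G S × ∣ S ∣ ≡ k)

{-# OPTIONS --safe #-}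
-- Since deg v = 0 and deg₂ v ≤ 1, at most one vertex u is joined to v by a pair of E ∪ ℰ.
-- A maximum 2-packing S avoiding v therefore conflicts with v only through u, and
-- (S ∖ {u}) ∪ {v} is again a 2-packing, no smaller than S. Given a maximum 2-packing S₀ ∋ v,
-- S₀ ∖ {v} is a 2-packing of 𝒢[V ∖ N²[v]], while adding v to a 2-packing of 𝒢[V ∖ N²[v]]
-- gives one of 𝒢; so β(𝒢) = β(𝒢[V ∖ N²[v]]) + 1.
module Submission where

open import Defs hiding (sym)
open import Data.Bool using (Bool; true; _∧_; not)
import Data.Bool as Bool
open import Data.Bool.Properties using (∧-comm; ∧-conicalˡ; ∧-conicalʳ)
open import Data.Fin using (Fin; zero; suc; _≟_)
open import Data.Fin.Properties using (any?; all?)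
open import Data.Fin.Subset using (Subset; inside; outside; _∈_; _∉_; _⊆_; _─_; _-_; _∪_; ⁅_⁆; ⊥; ∣_∣)
open import Data.Fin.Subset.Properties
  using ( _∈?_; _⊆?_; anySubset?; ∉⊥; ∣p∣≤n; p⊆p∪q; x∈p∪q⁺; x∈p∪q⁻; x∈⁅x⁆; x∈⁅y⁆⇒x≡y
        ; x∉⁅y⁆⇒x≢y; p─⊥≡p; p─q⊆p; x∈p∧x∉q⇒x∈p─q; x∈p∧x≢y⇒x∈p-y; x∈p⇒∣p-x∣<∣p∣; p⊂q⇒∣p∣<∣q∣ )
open import Data.Nat using (ℕ; suc; _≤_; _<_; _≤?_; z≤n; s≤s; s≤s⁻¹)
open import Data.Nat.Properties using (≤-refl; ≤-trans; ≤-antisym; n≤1+n; n≮0; n≤0⇒n≡0; ≰⇒>; module ≤-Reasoning)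
open import Data.Product using (Σ; ∃; _×_; _,_; proj₁; proj₂)
open import Data.Sum using (_⊎_; inj₁; inj₂; [_,_]′)
import Data.Sum as Sum
open import Data.Vec using (_∷_; tabulate; here; there)
open import Data.Vec.Properties using (lookup∘tabulate; []=⇒lookup; lookup⇒[]=)
open import Function using (_∘_)
open import Function.Bundles using (_⇔_; mk⇔; Equivalence)
open import Relation.Nullary using (¬_; Dec; yes; no; contradiction)
open import Relation.Nullary.Decidable using (_×-dec_; _⊎-dec_; _→-dec_; ¬?; map′; dec-true; does-⇔)
open import Relation.Unary using (Pred; Decidable)
open import Relation.Binary.PropositionalEquality using (_≡_; _≢_; refl; sym; trans; cong₂; subst; module ≡-Reasoning)

open Equivalence using (to; from)

x∈tabulate⇔ : ∀ {n} (f : Fin n → Bool) {x} → x ∈ tabulate f ⇔ f x ≡ true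
x∈tabulate⇔ f {x} = mk⇔
  (λ x∈f → trans (sym (lookup∘tabulate f x)) ([]=⇒lookup x∈f))
  (λ fx → lookup⇒[]= x (tabulate f) (trans (lookup∘tabulate f x) fx))

x∈p─q⇒x∉q : ∀ {n} {x : Fin n} (p q : Subset n) → x ∈ p ─ q → x ∉ q
x∈p─q⇒x∉q (inside ∷ p) (outside ∷ q) here ()
x∈p─q⇒x∉q (_ ∷ p) (_ ∷ q) (there x∈p─q) (there x∈q) = x∈p─q⇒x∉q p q x∈p─q x∈q

x∉p⇒∣p∣<∣p∪⁅x⁆∣ : ∀ {n} {x : Fin n} {p : Subset n} → x ∉ p → ∣ p ∣ < ∣ p ∪ ⁅ x ⁆ ∣
x∉p⇒∣p∣<∣p∪⁅x⁆∣ {x = x} x∉p = p⊂q⇒∣p∣<∣q∣ (p⊆p∪q ⁅ x ⁆ , x , x∈p∪q⁺ (inj₂ (x∈⁅x⁆ x)) , x∉p)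

∣p∣≤1+∣p-x∣ : ∀ {n} (p : Subset n) (x : Fin n) → ∣ p ∣ ≤ suc ∣ p - x ∣
∣p∣≤1+∣p-x∣ (outside ∷ p) zero    = subst (λ q → ∣ p ∣ ≤ suc ∣ q ∣) (sym (p─⊥≡p p)) (n≤1+n ∣ p ∣)
∣p∣≤1+∣p-x∣ (inside  ∷ p) zero    = subst (λ q → suc ∣ p ∣ ≤ suc ∣ q ∣) (sym (p─⊥≡p p)) ≤-refl
∣p∣≤1+∣p-x∣ (outside ∷ p) (suc x) = ∣p∣≤1+∣p-x∣ p x
∣p∣≤1+∣p-x∣ (inside  ∷ p) (suc x) = s≤s (∣p∣≤1+∣p-x∣ p x)

∣p∣≡0⇒x∉p : ∀ {n} {x : Fin n} {p : Subset n} → ∣ p ∣ ≡ 0 → x ∉ p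
∣p∣≡0⇒x∉p {x = x} {p} ∣p∣≡0 x∈p = n≮0 (subst (∣ p - x ∣ <_) ∣p∣≡0 (x∈p⇒∣p-x∣<∣p∣ x∈p))

∣p∣≤1⇒x∈p⇒y∈p⇒x≡y : ∀ {n} {x y : Fin n} {p : Subset n} → ∣ p ∣ ≤ 1 → x ∈ p → y ∈ p → x ≡ y
∣p∣≤1⇒x∈p⇒y∈p⇒x≡y {x = x} {y} {p} ∣p∣≤1 x∈p y∈p with x ≟ y
... | yes x≡y = x≡y
... | no  x≢y = contradiction (x∈p∧x≢y⇒x∈p-y y∈p (x≢y ∘ sym)) (∣p∣≡0⇒x∉p ∣p-x∣≡0)
  where
  ∣p-x∣≡0 : ∣ p - x ∣ ≡ 0
  ∣p-x∣≡0 = n≤0⇒n≡0 (s≤s⁻¹ (≤-trans (x∈p⇒∣p-x∣<∣p∣ x∈p) ∣p∣≤1))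

module _ {n ℓ} {P : Pred (Subset n) ℓ} (P? : Decidable P) where

  ∃-largest : P ⊥ → ∃ λ S → P S × (∀ T → P T → ∣ T ∣ ≤ ∣ S ∣)
  ∃-largest P⊥ = search n (λ T _ → ∣p∣≤n T)
    where
    search : ∀ m → (∀ T → P T → ∣ T ∣ ≤ m) → ∃ λ S → P S × (∀ T → P T → ∣ T ∣ ≤ ∣ S ∣)
    search m bounded with anySubset? (λ S → P? S ×-dec m ≤? ∣ S ∣)
    ... | yes (S , PS , m≤∣S∣) = S , PS , λ T PT → ≤-trans (bounded T PT) m≤∣S∣
    search ℕ.zero    _ | no none = contradiction (⊥ , P⊥ , z≤n) none
    search (suc m) _ | no none = search m λ T PT → s≤s⁻¹ (≰⇒> λ m<∣T∣ → none (T , PT , m<∣T∣))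

∧≡true⇒ : ∀ a {b} → a ∧ b ≡ true → a ≡ true × b ≡ true
∧≡true⇒ a {b} e = ∧-conicalˡ a b e , ∧-conicalʳ a b e

commonNeighbour-sym : ∀ {n} (H : SimpleGraph n) x y w → adj H x w ∧ adj H w y ≡ adj H y w ∧ adj H w x
commonNeighbour-sym H x y w = begin
  adj H x w ∧ adj H w y  ≡⟨ ∧-comm (adj H x w) (adj H w y) ⟩
  adj H w y ∧ adj H x w  ≡⟨ cong₂ _∧_ (SimpleGraph.sym H w y) (SimpleGraph.sym H x w) ⟩
  adj H y w ∧ adj H w x  ∎
  where open ≡-Reasoning

extH-sym : ∀ {n} (H : SimpleGraph n) x y → extH H x y ≡ extH H y x
extH-sym H x y = cong₂ (λ a b → not a ∧ b) (does-⇔ (mk⇔ sym sym) (x ≟ y) (y ≟ x))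
  (cong₂ (λ a b → not a ∧ b) (SimpleGraph.sym H x y) (does-⇔ (mk⇔ (swap x y) (swap y x)) (any? _) (any? _)))
  where
  swap : ∀ x y → ∃ (λ w → adj H x w ∧ adj H w y ≡ true) → ∃ (λ w → adj H y w ∧ adj H w x ≡ true)
  swap x y (w , e) = w , trans (sym (commonNeighbour-sym H x y w)) e

Close : ∀ {n} → ExtGraph n → Fin n → Fin n → Set
Close G x y = EdgeE G x y ⊎ EdgeEx G x y

Close-sym : ∀ {n} (G : ExtGraph n) {x y} → Close G x y → Close G y x
Close-sym G {x} {y} (inj₁ (x∈V , y∈V , e)) = inj₁ (y∈V , x∈V , trans (SimpleGraph.sym (host G) y x) e)
Close-sym G {x} {y} (inj₂ (x∈V , y∈V , e)) = inj₂ (y∈V , x∈V , trans (extH-sym (host G) y x) e)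

Close-rebase : ∀ {n} (G : ExtGraph n) {W : Subset n} {x y} →
               x ∈ W → y ∈ W → Close G x y → Close (induced G W) x y
Close-rebase G x∈W y∈W (inj₁ (_ , _ , e)) = inj₁ (x∈W , y∈W , e)
Close-rebase G x∈W y∈W (inj₂ (_ , _ , e)) = inj₂ (x∈W , y∈W , e)

close? : ∀ {n} (G : ExtGraph n) x y → Dec (Close G x y)
close? G x y = edge? (adj (host G) x y) ⊎-dec edge? (extH (host G) x y)
  where
  edge? : ∀ b → Dec (x ∈ V G × y ∈ V G × b ≡ true)
  edge? b = x ∈? V G ×-dec y ∈? V G ×-dec b Bool.≟ true

∈V⇔inV : ∀ {n} (G : ExtGraph n) {x} → x ∈ V G ⇔ inV G x ≡ true
∈V⇔inV G {x} = mk⇔ (dec-true (x ∈? V G)) inV⇒∈V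
  where
  inV⇒∈V : inV G x ≡ true → x ∈ V G
  inV⇒∈V with x ∈? V G
  ... | yes x∈V = λ _ → x∈V
  ... | no  _   = λ ()

∈tabulate-edge⇔ : ∀ {n} (G : ExtGraph n) (e : Fin n → Fin n → Bool) {x v} →
                  x ∈ tabulate (λ y → inV G y ∧ inV G v ∧ e y v) ⇔ (x ∈ V G × v ∈ V G × e x v ≡ true)
∈tabulate-edge⇔ G e {x} {v} = mk⇔ split join
  where
  split : x ∈ tabulate (λ y → inV G y ∧ inV G v ∧ e y v) → x ∈ V G × v ∈ V G × e x v ≡ true
  split x∈ with ∧≡true⇒ (inV G x) (to (x∈tabulate⇔ _) x∈)
  ... | x∈V , rest with ∧≡true⇒ (inV G v) rest
  ... | v∈V , exv = from (∈V⇔inV G) x∈V , from (∈V⇔inV G) v∈V , exv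
  join : x ∈ V G × v ∈ V G × e x v ≡ true → x ∈ tabulate (λ y → inV G y ∧ inV G v ∧ e y v)
  join (x∈V , v∈V , exv) =
    from (x∈tabulate⇔ _) (cong₂ _∧_ (to (∈V⇔inV G) x∈V) (cong₂ _∧_ (to (∈V⇔inV G) v∈V) exv))

∈N⇔EdgeE : ∀ {n} (G : ExtGraph n) {x v} → x ∈ N G v ⇔ EdgeE G x v
∈N⇔EdgeE G = ∈tabulate-edge⇔ G (adj (host G))

∈N²⇔EdgeEx : ∀ {n} (G : ExtGraph n) {x v} → x ∈ N² G v ⇔ EdgeEx G x v
∈N²⇔EdgeEx G = ∈tabulate-edge⇔ G (extH (host G))

∈N²[]⇔ : ∀ {n} (G : ExtGraph n) {x v} → x ∈ N²[ G ] v ⇔ (Close G x v ⊎ x ≡ v)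
∈N²[]⇔ G {x} {v} = mk⇔ split join
  where
  split : x ∈ N²[ G ] v → Close G x v ⊎ x ≡ v
  split x∈ with x∈p∪q⁻ (N² G v) (N[ G ] v) x∈
  ... | inj₁ x∈N² = inj₁ (inj₂ (to (∈N²⇔EdgeEx G) x∈N²))
  ... | inj₂ x∈N[] with x∈p∪q⁻ (N G v) ⁅ v ⁆ x∈N[]
  ... | inj₁ x∈N = inj₁ (inj₁ (to (∈N⇔EdgeE G) x∈N))
  ... | inj₂ x∈⁅v⁆ = inj₂ (x∈⁅y⁆⇒x≡y v x∈⁅v⁆)
  join : Close G x v ⊎ x ≡ v → x ∈ N²[ G ] v
  join (inj₁ (inj₂ x-v)) = x∈p∪q⁺ (inj₁ (from (∈N²⇔EdgeEx G) x-v))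
  join (inj₁ (inj₁ x-v)) = x∈p∪q⁺ (inj₂ (x∈p∪q⁺ (inj₁ (from (∈N⇔EdgeE G) x-v))))
  join (inj₂ refl)       = x∈p∪q⁺ (inj₂ (x∈p∪q⁺ (inj₂ (x∈⁅x⁆ v))))

deg≡0⇒deg₂≤1⇒Close-unique : ∀ {n} (G : ExtGraph n) {v x y} → deg G v ≡ 0 → deg₂ G v ≤ 1 →
                              Close G x v → Close G y v → x ≡ y
deg≡0⇒deg₂≤1⇒Close-unique G deg≡0 _ (inj₁ x-v) _ =
  contradiction (from (∈N⇔EdgeE G) x-v) (∣p∣≡0⇒x∉p deg≡0)
deg≡0⇒deg₂≤1⇒Close-unique G deg≡0 _ (inj₂ _) (inj₁ y-v) =
  contradiction (from (∈N⇔EdgeE G) y-v) (∣p∣≡0⇒x∉p deg≡0)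
deg≡0⇒deg₂≤1⇒Close-unique G _ deg₂≤1 (inj₂ x-v) (inj₂ y-v) =
  ∣p∣≤1⇒x∈p⇒y∈p⇒x≡y deg₂≤1 (from (∈N²⇔EdgeEx G) x-v) (from (∈N²⇔EdgeEx G) y-v)

isTwoPacking? : ∀ {n} (G : ExtGraph n) S → Dec (IsTwoPacking G S)
isTwoPacking? G S = S ⊆? V G ×-dec map′ (λ sep {x} {y} → sep x y) (λ sep x y → sep {x} {y})
  (all? λ x → all? λ y → x ∈? S →-dec y ∈? S →-dec ¬? (x ≟ y) →-dec ¬? (close? G x y))

⊥-isTwoPacking : ∀ {n} (G : ExtGraph n) → IsTwoPacking G ⊥
⊥-isTwoPacking G = (λ x∈⊥ → contradiction x∈⊥ ∉⊥) , (λ x∈⊥ → contradiction x∈⊥ ∉⊥)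

maxTwoPacking : ∀ {n} (G : ExtGraph n) → ∃ (IsMaxTwoPacking G)
maxTwoPacking G = ∃-largest (isTwoPacking? G) (⊥-isTwoPacking G)

IsTwoPacking-⊆ : ∀ {n} {G : ExtGraph n} {S T} → T ⊆ S → IsTwoPacking G S → IsTwoPacking G T
IsTwoPacking-⊆ T⊆S (S⊆V , sep) = S⊆V ∘ T⊆S , λ x∈T y∈T → sep (T⊆S x∈T) (T⊆S y∈T)

IsTwoPacking-∪⁅⁆ : ∀ {n} {G : ExtGraph n} {S v} → IsTwoPacking G S → v ∈ V G →
                   (∀ {x} → x ∈ S → ¬ Close G x v) → IsTwoPacking G (S ∪ ⁅ v ⁆)
IsTwoPacking-∪⁅⁆ {G = G} {S} {v} (S⊆V , sep) v∈V far = S∪v⊆V , sep′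
  where
  cases : ∀ {x} → x ∈ S ∪ ⁅ v ⁆ → x ∈ S ⊎ x ≡ v
  cases x∈ = Sum.map₂ (x∈⁅y⁆⇒x≡y v) (x∈p∪q⁻ S ⁅ v ⁆ x∈)
  S∪v⊆V : S ∪ ⁅ v ⁆ ⊆ V G
  S∪v⊆V x∈ with cases x∈
  ... | inj₁ x∈S = S⊆V x∈S
  ... | inj₂ refl = v∈V
  sep′ : ∀ {x y} → x ∈ S ∪ ⁅ v ⁆ → y ∈ S ∪ ⁅ v ⁆ → x ≢ y → ¬ Close G x y
  sep′ x∈ y∈ x≢y with cases x∈ | cases y∈
  ... | inj₁ x∈S | inj₁ y∈S = sep x∈S y∈S x≢y
  ... | inj₁ x∈S | inj₂ refl = far x∈S
  ... | inj₂ refl | inj₁ y∈S = far y∈S ∘ Close-sym G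
  ... | inj₂ refl | inj₂ refl = contradiction refl x≢y

swap-isMaxTwoPacking : ∀ {n} {G : ExtGraph n} {S u v} → IsMaxTwoPacking G S → v ∈ V G → v ∉ S →
                       (∀ {x} → x ∈ S → Close G x v → x ≡ u) → IsMaxTwoPacking G ((S - u) ∪ ⁅ v ⁆)
swap-isMaxTwoPacking {G = G} {S} {u} {v} (S-pack , S-max) v∈V v∉S onlyU = S′-pack , S′-max
  where
  S-u⊆S : S - u ⊆ S
  S-u⊆S = p─q⊆p S ⁅ u ⁆
  S′-pack : IsTwoPacking G ((S - u) ∪ ⁅ v ⁆)
  S′-pack = IsTwoPacking-∪⁅⁆ {G = G} (IsTwoPacking-⊆ {G = G} S-u⊆S S-pack) v∈V
    λ x∈S-u x-v → x∉⁅y⁆⇒x≢y (x∈p─q⇒x∉q S ⁅ u ⁆ x∈S-u) (onlyU (S-u⊆S x∈S-u) x-v)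
  S′-max : ∀ T → IsTwoPacking G T → ∣ T ∣ ≤ ∣ (S - u) ∪ ⁅ v ⁆ ∣
  S′-max T T-pack = begin
    ∣ T ∣                ≤⟨ S-max T T-pack ⟩
    ∣ S ∣                ≤⟨ ∣p∣≤1+∣p-x∣ S u ⟩
    suc ∣ S - u ∣        ≤⟨ x∉p⇒∣p∣<∣p∪⁅x⁆∣ (v∉S ∘ S-u⊆S) ⟩
    ∣ (S - u) ∪ ⁅ v ⁆ ∣  ∎
    where open ≤-Reasoning

maxTwoPacking-∋ : ∀ {n} (G : ExtGraph n) {v} → v ∈ V G → (∀ {x y} → Close G x v → Close G y v → x ≡ y) →
                  ∃ λ S → IsMaxTwoPacking G S × v ∈ S
maxTwoPacking-∋ G {v} v∈V unique with maxTwoPacking G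
... | S , S-max with v ∈? S
... | yes v∈S = S , S-max , v∈S
... | no  v∉S = _ , swap-isMaxTwoPacking {G = G} S-max v∈V v∉S (proj₂ onlyOne) , x∈p∪q⁺ (inj₂ (x∈⁅x⁆ v))
  where
  onlyOne : ∃ λ u → ∀ {x} → x ∈ S → Close G x v → x ≡ u
  onlyOne with any? (λ u → u ∈? S ×-dec close? G u v)
  ... | yes (u , _ , u-v) = u , λ _ x-v → unique x-v u-v
  -- no vertex of S is close to v, so the choice u := v is arbitrary
  ... | no  none = v , λ x∈S x-v → contradiction (_ , x∈S , x-v) none

IsTwoPacking-extend : ∀ {n} {G : ExtGraph n} {v T} → v ∈ V G →
                               IsTwoPacking (induced G (V G ─ N²[ G ] v)) T → IsTwoPacking G (T ∪ ⁅ v ⁆)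
IsTwoPacking-extend {G = G} {v} v∈V (T⊆V′ , sep) = IsTwoPacking-∪⁅⁆ {G = G} (T⊆V , sepᴳ) v∈V far
  where
  T⊆V : _ ⊆ V G
  T⊆V = p─q⊆p (V G) (N²[ G ] v) ∘ T⊆V′
  sepᴳ : ∀ {x y} → x ∈ _ → y ∈ _ → x ≢ y → ¬ Close G x y
  sepᴳ x∈T y∈T x≢y = sep x∈T y∈T x≢y ∘ Close-rebase G (T⊆V′ x∈T) (T⊆V′ y∈T)
  far : ∀ {x} → x ∈ _ → ¬ Close G x v
  far x∈T x-v = x∈p─q⇒x∉q (V G) (N²[ G ] v) (T⊆V′ x∈T) (from (∈N²[]⇔ G) (inj₁ x-v))

IsTwoPacking-restrict : ∀ {n} {G : ExtGraph n} {v S} → IsTwoPacking G S → v ∈ S →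
                     IsTwoPacking (induced G (V G ─ N²[ G ] v)) (S - v)
IsTwoPacking-restrict {G = G} {v} {S} (S⊆V , sep) v∈S = S-v⊆V′ , sep′
  where
  S-v⊆S : S - v ⊆ S
  S-v⊆S = p─q⊆p S ⁅ v ⁆
  S-v⊆V′ : S - v ⊆ V G ─ N²[ G ] v
  S-v⊆V′ x∈ = x∈p∧x∉q⇒x∈p─q (S⊆V x∈S) λ x∈N²[] → [ sep x∈S v∈S x≢v , x≢v ]′ (to (∈N²[]⇔ G) x∈N²[])
    where
    x∈S = S-v⊆S x∈
    x≢v = x∉⁅y⁆⇒x≢y (x∈p─q⇒x∉q S ⁅ v ⁆ x∈)
  sep′ : ∀ {x y} → x ∈ S - v → y ∈ S - v → x ≢ y → ¬ Close (induced G (V G ─ N²[ G ] v)) x y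
  sep′ x∈ y∈ x≢y = sep (S-v⊆S x∈) (S-v⊆S y∈) x≢y
                 ∘ Close-rebase (induced G (V G ─ N²[ G ] v)) (S⊆V (S-v⊆S x∈)) (S⊆V (S-v⊆S y∈))

β≡1+β-outsideN²[] : ∀ {n} {G : ExtGraph n} {v S₀} → IsMaxTwoPacking G S₀ → v ∈ S₀ →
                    ∀ {b b′} → IsBeta G b → IsBeta (induced G (V G ─ N²[ G ] v)) b′ → b ≡ suc b′
β≡1+β-outsideN²[] {G = G} {v} {S₀} (S₀-pack , S₀-max) v∈S₀
                  (S , (S-pack , S-max) , refl) (T , (T-pack , T-max) , refl) =
  ≤-antisym ∣S∣≤1+∣T∣ 1+∣T∣≤∣S∣
  where
  open ≤-Reasoning
  ∣S∣≤1+∣T∣ : ∣ S ∣ ≤ suc ∣ T ∣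
  ∣S∣≤1+∣T∣ = begin
    ∣ S ∣           ≤⟨ S₀-max S S-pack ⟩
    ∣ S₀ ∣          ≤⟨ ∣p∣≤1+∣p-x∣ S₀ v ⟩
    suc ∣ S₀ - v ∣  ≤⟨ s≤s (T-max (S₀ - v) (IsTwoPacking-restrict {G = G} S₀-pack v∈S₀)) ⟩
    suc ∣ T ∣       ∎
  v∉T : v ∉ T
  v∉T v∈T = x∈p─q⇒x∉q (V G) (N²[ G ] v) (T-pack .proj₁ v∈T) (from (∈N²[]⇔ G) (inj₂ refl))
  1+∣T∣≤∣S∣ : suc ∣ T ∣ ≤ ∣ S ∣
  1+∣T∣≤∣S∣ = begin
    suc ∣ T ∣      ≤⟨ x∉p⇒∣p∣<∣p∪⁅x⁆∣ v∉T ⟩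
    ∣ T ∪ ⁅ v ⁆ ∣  ≤⟨ S-max (T ∪ ⁅ v ⁆) (IsTwoPacking-extend {G = G} (S₀-pack .proj₁ v∈S₀) T-pack) ⟩
    ∣ S ∣          ∎

mainTheorem4 : ∀ {n} (G : ExtGraph n) (v : Fin n) →
    v ∈ V G → deg G v ≡ 0 → deg₂ G v ≤ 1 →
    Σ (Subset n) (λ S → IsMaxTwoPacking G S × v ∈ S) ×
    (∀ b b′ → IsBeta G b → IsBeta (induced G (V G ─ N²[ G ] v)) b′ → b ≡ suc b′)
mainTheorem4 G v v∈V deg≡0 deg₂≤1 =
  let S₀ , S₀-max , v∈S₀ = maxTwoPacking-∋ G v∈V (deg≡0⇒deg₂≤1⇒Close-unique G deg≡0 deg₂≤1)
  in  (S₀ , S₀-max , v∈S₀) , λ _ _ → β≡1+β-outsideN²[] {G = G} S₀-max v∈S₀
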